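{- Let $V$ be a value of the call-by-value $\lambda\mu^{\wedge\vee}$-calculus and $W$ a term. If $V \triangleright^*_v W$, then $W$ is a value.
   Context: Fix two disjoint infinite sets of variables: $\lambda$-variables $x,y,\dots$ and $\mu$-variables $a,b,\dots$. Terms $\mathcal{T}$ and $\mathcal{E}$-terms $\mathcal{E}$ are given by $\mathcal{T} ::= x \mid \lambda x.\mathcal{T} \mid (\mathcal{T}\ \mathcal{E}) \mid \langle \mathcal{T},\mathcal{T}\rangle \mid \omega_1\mathcal{T} \mid \omega_2 \mathcal{T} \mid \mu a.\mathcal{T} \mid (a\ \mathcal{T})$, $\mathcal{E} ::= \mathcal{T} \mid \pi_1 \mid \pi_2 \mid [x.\mathcal{T}, y.\mathcal{T}]$. Values are given by $V ::= x \mid \lambda x.\mathcal{T} \mid \langle V, V\rangle \mid \omega_1 V \mid \omega_2 V \mid (a\ \mathcal{T})$. For a term $t$, $t[a:=^*\varepsilon]$ replaces inductively each subterm $(a\ v)$ by $(a\ (v\ \varepsilon))$, and $t[a:=_*V]$ replaces inductively each subterm $(a\ u)$ by $(a\ (V\ u))$. The one-step reduction $\triangleright_v$ is the compatible closure of the rules ($V,V_i$ values, $i\in\{1,2\}$): $(\lambda x.t\ V) \triangleright t[x:=V]$; $(\langle V_1,V_2\rangle\ \pi_i) \triangleright V_i$; $(\omega_i V\ [x_1.t_1,x_2.t_2]) \triangleright t_i[x_i:=V]$; $((t\ [x_1.t_1,x_2.t_2])\ \varepsilon) \triangleright (t\ [x_1.(t_1\ \varepsilon), x_2.(t_2\ \varepsilon)])$;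 $(V\ (t\ [x_1.t_1,x_2.t_2])) \triangleright (t\ [x_1.(V\ t_1), x_2.(V\ t_2)])$; $(\mu a.t\ \varepsilon) \triangleright \mu a.t[a:=^*\varepsilon]$; $(V\ \mu a.t) \triangleright \mu a.t[a:=_*V]$. $\triangleright^*_v$ is the reflexive–transitive closure of $\triangleright_v$. -}

module Defs where

-- Call-by-value λμ^{∧∨}-calculus, with (nameless) de Bruijn indices for
-- both sorts of variables: λ-variables and μ-variables live in two
-- separate index spaces (terms are thus identified up to α-conversion).

open import Data.Nat using (ℕ; zero; suc; _≟_)
open import Relation.Nullary using (yes; no)
open import Relation.Binary.Construct.Closure.ReflexiveTransitive using (Star)

mutual
  data Term : Set where
    var  : ℕ → Term
    lam  : Term → Term              -- λx.t         (binds one λ-variable)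
    app  : Term → ETerm → Term
    pair : Term → Term → Term
    ω₁   : Term → Term
    ω₂   : Term → Term
    mu   : Term → Term              -- μa.t         (binds one μ-variable)
    nm   : ℕ → Term → Term          -- (a t)        (μ-variable, de Bruijn index)

  data ETerm : Set where
    tm   : Term → ETerm
    π₁   : ETerm
    π₂   : ETerm
    case : Term → Term → ETerm      -- [x.t₁, y.t₂] (each branch binds one λ-variable)

data Value : Term → Set where
  v-var  : ∀ {i} → Value (var i)
  v-lam  : ∀ {t} → Value (lam t)
  v-pair : ∀ {V₁ V₂} → Value V₁ → Value V₂ → Value (pair V₁ V₂)
  v-ω₁   : ∀ {V} → Value V → Value (ω₁ V)
  v-ω₂   : ∀ {V} → Value V → Value (ω₂ V)
  v-nm   : ∀ {a t} → Value (nm a t)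

ext : (ℕ → ℕ) → ℕ → ℕ
ext ρ zero    = zero
ext ρ (suc i) = suc (ρ i)

mutual
  renλ : (ℕ → ℕ) → Term → Term
  renλ ρ (var i)    = var (ρ i)
  renλ ρ (lam t)    = lam (renλ (ext ρ) t)
  renλ ρ (app t e)  = app (renλ ρ t) (renλE ρ e)
  renλ ρ (pair t u) = pair (renλ ρ t) (renλ ρ u)
  renλ ρ (ω₁ t)     = ω₁ (renλ ρ t)
  renλ ρ (ω₂ t)     = ω₂ (renλ ρ t)
  renλ ρ (mu t)     = mu (renλ ρ t)
  renλ ρ (nm a t)   = nm a (renλ ρ t)

  renλE : (ℕ → ℕ) → ETerm → ETerm
  renλE ρ (tm t)       = tm (renλ ρ t)
  renλE ρ π₁           = π₁
  renλE ρ π₂           = π₂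
  renλE ρ (case t₁ t₂) = case (renλ (ext ρ) t₁) (renλ (ext ρ) t₂)

mutual
  renμ : (ℕ → ℕ) → Term → Term
  renμ σ (var i)    = var i
  renμ σ (lam t)    = lam (renμ σ t)
  renμ σ (app t e)  = app (renμ σ t) (renμE σ e)
  renμ σ (pair t u) = pair (renμ σ t) (renμ σ u)
  renμ σ (ω₁ t)     = ω₁ (renμ σ t)
  renμ σ (ω₂ t)     = ω₂ (renμ σ t)
  renμ σ (mu t)     = mu (renμ (ext σ) t)
  renμ σ (nm a t)   = nm (σ a) (renμ σ t)

  renμE : (ℕ → ℕ) → ETerm → ETerm
  renμE σ (tm t)       = tm (renμ σ t)
  renμE σ π₁           = π₁
  renμE σ π₂           = π₂
  renμE σ (case t₁ t₂) = case (renμ σ t₁) (renμ σ t₂)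

wkλ : Term → Term
wkλ = renλ suc

wkλE : ETerm → ETerm
wkλE = renλE suc

wkμ : Term → Term
wkμ = renμ suc

wkμE : ETerm → ETerm
wkμE = renμE suc

exts : (ℕ → Term) → ℕ → Term
exts s zero    = var zero
exts s (suc i) = wkλ (s i)

mutual
  sub : (ℕ → Term) → Term → Term
  sub s (var i)    = s i
  sub s (lam t)    = lam (sub (exts s) t)
  sub s (app t e)  = app (sub s t) (subE s e)
  sub s (pair t u) = pair (sub s t) (sub s u)
  sub s (ω₁ t)     = ω₁ (sub s t)
  sub s (ω₂ t)     = ω₂ (sub s t)
  sub s (mu t)     = mu (sub (λ i → wkμ (s i)) t)
  sub s (nm a t)   = nm a (sub s t)

  subE : (ℕ → Term) → ETerm → ETerm
  subE s (tm t)       = tm (sub s t)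
  subE s π₁           = π₁
  subE s π₂           = π₂
  subE s (case t₁ t₂) = case (sub (exts s) t₁) (sub (exts s) t₂)

single : Term → ℕ → Term
single V zero    = V
single V (suc i) = var i

-- t[x:=V], x being the λ-variable bound by the outermost binder (index 0)
_[0:=_] : Term → Term → Term
t [0:= V ] = sub (single V) t

-- μ-substitutions
-- rsub k ε t  =  t[a:=^* ε] where a has de Bruijn index k:
--   every subterm (a u) becomes (a (u' ε)), u' the recursively treated u.
mutual
  rsub : ℕ → ETerm → Term → Term
  rsub k ε (var i)    = var i
  rsub k ε (lam t)    = lam (rsub k (wkλE ε) t)
  rsub k ε (app t e)  = app (rsub k ε t) (rsubE k ε e)
  rsub k ε (pair t u) = pair (rsub k ε t) (rsub k ε u)
  rsub k ε (ω₁ t)     = ω₁ (rsub k ε t)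
  rsub k ε (ω₂ t)     = ω₂ (rsub k ε t)
  rsub k ε (mu t)     = mu (rsub (suc k) (wkμE ε) t)
  rsub k ε (nm a t) with a ≟ k
  ... | yes _ = nm a (app (rsub k ε t) ε)
  ... | no  _ = nm a (rsub k ε t)

  rsubE : ℕ → ETerm → ETerm → ETerm
  rsubE k ε (tm t)       = tm (rsub k ε t)
  rsubE k ε π₁           = π₁
  rsubE k ε π₂           = π₂
  rsubE k ε (case t₁ t₂) = case (rsub k (wkλE ε) t₁) (rsub k (wkλE ε) t₂)

-- lsub k V t  =  t[a:=_* V] where a has de Bruijn index k:
--   every subterm (a u) becomes (a (V u')), u' the recursively treated u.
mutual
  lsub : ℕ → Term → Term → Term
  lsub k V (var i)    = var i
  lsub k V (lam t)    = lam (lsub k (wkλ V) t)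
  lsub k V (app t e)  = app (lsub k V t) (lsubE k V e)
  lsub k V (pair t u) = pair (lsub k V t) (lsub k V u)
  lsub k V (ω₁ t)     = ω₁ (lsub k V t)
  lsub k V (ω₂ t)     = ω₂ (lsub k V t)
  lsub k V (mu t)     = mu (lsub (suc k) (wkμ V) t)
  lsub k V (nm a t) with a ≟ k
  ... | yes _ = nm a (app V (tm (lsub k V t)))
  ... | no  _ = nm a (lsub k V t)

  lsubE : ℕ → Term → ETerm → ETerm
  lsubE k V (tm t)       = tm (lsub k V t)
  lsubE k V π₁           = π₁
  lsubE k V π₂           = π₂
  lsubE k V (case t₁ t₂) = case (lsub k (wkλ V) t₁) (lsub k (wkλ V) t₂)

infix 4 _▷_ _▷ᴱ_ _▷*_

mutual
  data _▷_ : Term → Term → Set where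
    β→   : ∀ {t V} → Value V → app (lam t) (tm V) ▷ t [0:= V ]
    β∧₁  : ∀ {V₁ V₂} → Value V₁ → Value V₂ → app (pair V₁ V₂) π₁ ▷ V₁
    β∧₂  : ∀ {V₁ V₂} → Value V₁ → Value V₂ → app (pair V₁ V₂) π₂ ▷ V₂
    β∨₁  : ∀ {V t₁ t₂} → Value V → app (ω₁ V) (case t₁ t₂) ▷ t₁ [0:= V ]
    β∨₂  : ∀ {V t₁ t₂} → Value V → app (ω₂ V) (case t₁ t₂) ▷ t₂ [0:= V ]
    δʳ   : ∀ {t t₁ t₂ ε} →
           app (app t (case t₁ t₂)) ε ▷
           app t (case (app t₁ (wkλE ε)) (app t₂ (wkλE ε)))
    δˡ   : ∀ {V t t₁ t₂} → Value V →
           app V (tm (app t (case t₁ t₂))) ▷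
           app t (case (app (wkλ V) (tm t₁)) (app (wkλ V) (tm t₂)))
    μʳ   : ∀ {t ε} → app (mu t) ε ▷ mu (rsub zero (wkμE ε) t)
    μˡ   : ∀ {V t} → Value V → app V (tm (mu t)) ▷ mu (lsub zero (wkμ V) t)
    c-lam   : ∀ {t t'} → t ▷ t' → lam t ▷ lam t'
    c-appˡ  : ∀ {t t' e} → t ▷ t' → app t e ▷ app t' e
    c-appʳ  : ∀ {t e e'} → e ▷ᴱ e' → app t e ▷ app t e'
    c-pairˡ : ∀ {t t' u} → t ▷ t' → pair t u ▷ pair t' u
    c-pairʳ : ∀ {t u u'} → u ▷ u' → pair t u ▷ pair t u'
    c-ω₁    : ∀ {t t'} → t ▷ t' → ω₁ t ▷ ω₁ t'
    c-ω₂    : ∀ {t t'} → t ▷ t' → ω₂ t ▷ ω₂ t'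
    c-mu    : ∀ {t t'} → t ▷ t' → mu t ▷ mu t'
    c-nm    : ∀ {a t t'} → t ▷ t' → nm a t ▷ nm a t'

  data _▷ᴱ_ : ETerm → ETerm → Set where
    c-tm    : ∀ {t t'} → t ▷ t' → tm t ▷ᴱ tm t'
    c-caseˡ : ∀ {t₁ t₁' t₂} → t₁ ▷ t₁' → case t₁ t₂ ▷ᴱ case t₁' t₂
    c-caseʳ : ∀ {t₁ t₂ t₂'} → t₂ ▷ t₂' → case t₁ t₂ ▷ᴱ case t₁ t₂'

_▷*_ : Term → Term → Set
_▷*_ = Star _▷_

module Submission where

open import Defs
open import Relation.Binary.Construct.Closure.ReflexiveTransitive using (ε; _◅_)

-- Every redex is an application, and no value is an application, so a
-- value can only step inside one of its immediate subterms.
▷-preserves-Value : ∀ {V W : Term} → Value V → V ▷ W → Value W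
▷-preserves-Value v-lam          (c-lam _)   = v-lam
▷-preserves-Value (v-pair V₁ V₂) (c-pairˡ r) = v-pair (▷-preserves-Value V₁ r) V₂
▷-preserves-Value (v-pair V₁ V₂) (c-pairʳ r) = v-pair V₁ (▷-preserves-Value V₂ r)
▷-preserves-Value (v-ω₁ V)       (c-ω₁ r)    = v-ω₁ (▷-preserves-Value V r)
▷-preserves-Value (v-ω₂ V)       (c-ω₂ r)    = v-ω₂ (▷-preserves-Value V r)
▷-preserves-Value v-nm           (c-nm _)    = v-nm

mainTheorem2 : ∀ {V W : Term} → Value V → V ▷* W → Value W
mainTheorem2 V ε        = V
mainTheorem2 V (r ◅ rs) = mainTheorem2 (▷-preserves-Value V r) rs
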